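{- Let $\mathcal{C}$ be a symmetric monoidal category. For any central idempotent $u\colon U\to I$ of $\mathcal{C}$ there is a comonad $-\otimes U$ on $\mathcal{C}$. More generally, for any central idempotents $u\leq v$ of $\mathcal{C}$, there is a comonad $-\otimes U$ on $\mathcal{C}|_v$.
   Context: A central idempotent in a symmetric monoidal category $\mathcal{C}$ (unit $I$, unitors $\lambda,\rho$) is a morphism $u\colon U\to I$ such that $\rho_U\circ(U\otimes u)=\lambda_U\circ(u\otimes U)\colon U\otimes U\to U$ and this morphism is invertible; $u\leq v$ means $u=v\circ m$ for some morphism $m\colon U\to V$. For a central idempotent $v$, $\mathcal{C}|_v$ is the symmetric monoidal category with the objects of $\mathcal{C}$, morphisms $A\to B$ being morphisms $A\otimes V\to B$ of $\mathcal{C}$, composition of $f\colon A\otimes V\to B$ and $g\colon B\otimes V\to C$ given by $g\circ(f\otimes V)\circ(A\otimes V\otimes v)^{ -1}$, identity $A\otimes v$, tensor of objects as in $\mathcal{C}$, and tensor of $f\colon A\otimes V\to B$, $f'\colon A'\otimes V\to B'$ given by $(f\otimes f')\circ(A\otimes\sigma_{A',V}\otimes V)\circ(A\otimes A'\otimes V\otimes v)^{ -1}$. -}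

module Defs where

open import Level using (Level; _⊔_; suc)
open import Data.Product using (Σ; Σ-syntax; _×_; _,_)
open import Relation.Binary using (Rel; IsEquivalence)

record Category (o ℓ e : Level) : Set (suc (o ⊔ ℓ ⊔ e)) where
  infix  4 _≈_
  infixr 9 _∘_
  field
    Obj   : Set o
    Hom   : Obj → Obj → Set ℓ
    _≈_   : ∀ {A B} → Rel (Hom A B) e
    id    : ∀ {A} → Hom A A
    _∘_   : ∀ {A B C} → Hom B C → Hom A B → Hom A C
    equiv     : ∀ {A B} → IsEquivalence (_≈_ {A} {B})
    assoc     : ∀ {A B C D} {f : Hom A B} {g : Hom B C} {h : Hom C D} →
                (h ∘ g) ∘ f ≈ h ∘ (g ∘ f)
    identityˡ : ∀ {A B} {f : Hom A B} → id ∘ f ≈ f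
    identityʳ : ∀ {A B} {f : Hom A B} → f ∘ id ≈ f
    ∘-resp-≈  : ∀ {A B C} {f h : Hom B C} {g i : Hom A B} →
                f ≈ h → g ≈ i → f ∘ g ≈ h ∘ i

record SymmetricMonoidalCategory (o ℓ e : Level) : Set (suc (o ⊔ ℓ ⊔ e)) where
  field
    cat : Category o ℓ e
  open Category cat public
  infixr 10 _⊗₀_ _⊗₁_
  field
    _⊗₀_ : Obj → Obj → Obj
    _⊗₁_ : ∀ {A B C D} → Hom A B → Hom C D → Hom (A ⊗₀ C) (B ⊗₀ D)
    ⊗-identity : ∀ {A B} → id {A} ⊗₁ id {B} ≈ id
    ⊗-homomorphism : ∀ {A B C A' B' C'} {f : Hom A B} {g : Hom B C}
                     {f' : Hom A' B'} {g' : Hom B' C'} →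
                     (g ∘ f) ⊗₁ (g' ∘ f') ≈ (g ⊗₁ g') ∘ (f ⊗₁ f')
    ⊗-resp-≈ : ∀ {A B C D} {f f' : Hom A B} {g g' : Hom C D} →
               f ≈ f' → g ≈ g' → f ⊗₁ g ≈ f' ⊗₁ g'
    I : Obj
    λ⇒ : ∀ {A} → Hom (I ⊗₀ A) A
    λ⇐ : ∀ {A} → Hom A (I ⊗₀ A)
    ρ⇒ : ∀ {A} → Hom (A ⊗₀ I) A
    ρ⇐ : ∀ {A} → Hom A (A ⊗₀ I)
    α⇒ : ∀ {A B C} → Hom ((A ⊗₀ B) ⊗₀ C) (A ⊗₀ (B ⊗₀ C))
    α⇐ : ∀ {A B C} → Hom (A ⊗₀ (B ⊗₀ C)) ((A ⊗₀ B) ⊗₀ C)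
    σ  : ∀ {A B} → Hom (A ⊗₀ B) (B ⊗₀ A)
    λ-isoˡ : ∀ {A} → λ⇐ ∘ λ⇒ {A} ≈ id
    λ-isoʳ : ∀ {A} → λ⇒ ∘ λ⇐ {A} ≈ id
    ρ-isoˡ : ∀ {A} → ρ⇐ ∘ ρ⇒ {A} ≈ id
    ρ-isoʳ : ∀ {A} → ρ⇒ ∘ ρ⇐ {A} ≈ id
    α-isoˡ : ∀ {A B C} → α⇐ ∘ α⇒ {A} {B} {C} ≈ id
    α-isoʳ : ∀ {A B C} → α⇒ ∘ α⇐ {A} {B} {C} ≈ id
    σ-involutive : ∀ {A B} → σ {B} {A} ∘ σ {A} {B} ≈ id
    λ-natural : ∀ {A B} {f : Hom A B} → f ∘ λ⇒ ≈ λ⇒ ∘ (id ⊗₁ f)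
    ρ-natural : ∀ {A B} {f : Hom A B} → f ∘ ρ⇒ ≈ ρ⇒ ∘ (f ⊗₁ id)
    α-natural : ∀ {A B C A' B' C'} {f : Hom A A'} {g : Hom B B'} {h : Hom C C'} →
                (f ⊗₁ (g ⊗₁ h)) ∘ α⇒ ≈ α⇒ ∘ ((f ⊗₁ g) ⊗₁ h)
    σ-natural : ∀ {A B A' B'} {f : Hom A A'} {g : Hom B B'} →
                (g ⊗₁ f) ∘ σ ≈ σ ∘ (f ⊗₁ g)
    triangle : ∀ {A B} → (id {A} ⊗₁ λ⇒ {B}) ∘ α⇒ ≈ ρ⇒ ⊗₁ id
    pentagon : ∀ {A B C D} →
               (id {A} ⊗₁ α⇒ {B} {C} {D}) ∘ α⇒ {A} {B ⊗₀ C} {D} ∘ (α⇒ {A} {B} {C} ⊗₁ id {D})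
               ≈ α⇒ {A} {B} {C ⊗₀ D} ∘ α⇒ {A ⊗₀ B} {C} {D}
    hexagon  : ∀ {A B C} →
               α⇒ {B} {C} {A} ∘ σ {A} {B ⊗₀ C} ∘ α⇒ {A} {B} {C}
               ≈ (id {B} ⊗₁ σ {A} {C}) ∘ α⇒ {B} {A} {C} ∘ (σ {A} {B} ⊗₁ id {C})

module _ {o ℓ e} (𝒞 : SymmetricMonoidalCategory o ℓ e) where
  open SymmetricMonoidalCategory 𝒞

  record CentralIdempotent : Set (o ⊔ ℓ ⊔ e) where
    field
      U   : Obj
      u   : Hom U I
      central : ρ⇒ ∘ (id {U} ⊗₁ u) ≈ λ⇒ ∘ (u ⊗₁ id {U})
      μ⁻¹ : Hom U (U ⊗₀ U)
      μ-isoˡ : μ⁻¹ ∘ (ρ⇒ ∘ (id {U} ⊗₁ u)) ≈ id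
      μ-isoʳ : (ρ⇒ ∘ (id {U} ⊗₁ u)) ∘ μ⁻¹ ≈ id

    μ : Hom (U ⊗₀ U) U
    μ = ρ⇒ ∘ (id {U} ⊗₁ u)

  open CentralIdempotent

  _≤ᶜ_ : CentralIdempotent → CentralIdempotent → Set (ℓ ⊔ e)
  x ≤ᶜ y = Σ[ m ∈ Hom (U x) (U y) ] (u x ≈ u y ∘ m)

  -- The symmetric monoidal category C|_v (only the structure needed here:
  -- hom-sets, composition, identities, tensor of morphisms; the hom
  -- equality is that of C).
  module Restrict (v : CentralIdempotent) where
    V : Obj
    V = U v

    Homᵥ : Obj → Obj → Set ℓ
    Homᵥ A B = Hom (A ⊗₀ V) B

    -- (A ⊗ V ⊗ v)⁻¹ : A ⊗ V → (A ⊗ V) ⊗ V  (up to associator/unitor)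
    dup : ∀ {A} → Hom (A ⊗₀ V) ((A ⊗₀ V) ⊗₀ V)
    dup = α⇐ ∘ (id ⊗₁ μ⁻¹ v)

    _∘ᵥ_ : ∀ {A B C} → Homᵥ B C → Homᵥ A B → Homᵥ A C
    g ∘ᵥ f = g ∘ ((f ⊗₁ id) ∘ dup)

    idᵥ : ∀ {A} → Homᵥ A A
    idᵥ = ρ⇒ ∘ (id ⊗₁ u v)

    -- middle interchange (A ⊗ A') ⊗ (V ⊗ V) → (A ⊗ V) ⊗ (A' ⊗ V),
    -- i.e. A ⊗ σ_{A',V} ⊗ V with associators
    interchange : ∀ {A A'} → Hom ((A ⊗₀ A') ⊗₀ (V ⊗₀ V)) ((A ⊗₀ V) ⊗₀ (A' ⊗₀ V))
    interchange = α⇐ ∘ ((id ⊗₁ (α⇒ ∘ ((σ ⊗₁ id) ∘ α⇐))) ∘ α⇒)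

    _⊗ᵥ_ : ∀ {A B A' B'} → Homᵥ A B → Homᵥ A' B' → Homᵥ (A ⊗₀ A') (B ⊗₀ B')
    f ⊗ᵥ f' = (f ⊗₁ f') ∘ (interchange ∘ (id ⊗₁ μ⁻¹ v))

record IsComonad {o ℓ e : Level} (Ob : Set o) (H : Ob → Ob → Set ℓ)
                 (_≈_ : ∀ {A B} → H A B → H A B → Set e)
                 (idH : ∀ {A} → H A A)
                 (_∘_ : ∀ {A B C} → H B C → H A B → H A C)
                 (F₀ : Ob → Ob) (F₁ : ∀ {A B} → H A B → H (F₀ A) (F₀ B))
                 : Set (o ⊔ ℓ ⊔ e) where
  field
    F-resp-≈ : ∀ {A B} {f g : H A B} → f ≈ g → F₁ f ≈ F₁ g
    F-identity : ∀ {A} → F₁ (idH {A}) ≈ idH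
    F-homomorphism : ∀ {A B C} {f : H A B} {g : H B C} →
                     F₁ (g ∘ f) ≈ (F₁ g ∘ F₁ f)
    ε : ∀ A → H (F₀ A) A
    δ : ∀ A → H (F₀ A) (F₀ (F₀ A))
    ε-natural : ∀ {A B} {f : H A B} → (f ∘ ε A) ≈ (ε B ∘ F₁ f)
    δ-natural : ∀ {A B} {f : H A B} → (F₁ (F₁ f) ∘ δ A) ≈ (δ B ∘ F₁ f)
    counitˡ : ∀ {A} → (ε (F₀ A) ∘ δ A) ≈ idH
    counitʳ : ∀ {A} → (F₁ (ε A) ∘ δ A) ≈ idH
    coassoc : ∀ {A} → (δ (F₀ A) ∘ δ A) ≈ (F₁ (δ A) ∘ δ A)

-- A central idempotent u : U → I makes U a comonoid: the comultiplication is the inverse of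
-- μ = ρ ∘ (U ⊗ u), and it is coassociative because μ is associative, being a counit composed
-- with a unitor. A comonoid U gives the comonad − ⊗ U. The category 𝒞|ᵥ is the co-Kleisli
-- category of − ⊗ V, and the symmetry (A ⊗ W) ⊗ V ≅ (A ⊗ V) ⊗ W is a distributive law of
-- − ⊗ W over − ⊗ V; hence − ⊗ W lifts to a comonad on 𝒞|ᵥ, acting on morphisms by f ↦ f ⊗ᵥ idᵥ.
module Submission where

open import Defs
open import Level using (Level; _⊔_)
open import Data.Product using (_×_; _,_)
open import Relation.Binary.Bundles using (Setoid)
import Relation.Binary.Reasoning.Setoid as SetoidReasoning

module HomReasoning {o ℓ e} (𝒞 : Category o ℓ e) where
  open Category 𝒞

  hom-setoid : ∀ {A B} → Setoid ℓ e
  hom-setoid {A} {B} = record { Carrier = Hom A B ; _≈_ = _≈_ ; isEquivalence = equiv }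

  module _ {A B : Obj} where
    open Setoid (hom-setoid {A} {B}) public using (refl; sym; trans)
    open SetoidReasoning (hom-setoid {A} {B}) public

  private variable
    A B C D X : Obj

  infixr 4 _⟩∘⟨_ refl⟩∘⟨_
  infixl 5 _⟩∘⟨refl

  _⟩∘⟨_ : ∀ {f h : Hom B C} {g i : Hom A B} → f ≈ h → g ≈ i → f ∘ g ≈ h ∘ i
  _⟩∘⟨_ = ∘-resp-≈

  refl⟩∘⟨_ : ∀ {f : Hom B C} {g i : Hom A B} → g ≈ i → f ∘ g ≈ f ∘ i
  refl⟩∘⟨ p = refl ⟩∘⟨ p

  _⟩∘⟨refl : ∀ {f h : Hom B C} {g : Hom A B} → f ≈ h → f ∘ g ≈ h ∘ g
  p ⟩∘⟨refl = p ⟩∘⟨ refl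

  sym-assoc : ∀ {f : Hom A B} {g : Hom B C} {h : Hom C D} → h ∘ (g ∘ f) ≈ (h ∘ g) ∘ f
  sym-assoc = sym assoc

  assoc²′ : ∀ {a : Hom C D} {b : Hom B C} {c : Hom A B} {f : Hom X A} →
            (a ∘ (b ∘ c)) ∘ f ≈ a ∘ (b ∘ (c ∘ f))
  assoc²′ = trans assoc (refl⟩∘⟨ assoc)

  pullˡ : ∀ {a : Hom B C} {b : Hom A B} {c : Hom A C} {f : Hom X A} →
          a ∘ b ≈ c → a ∘ (b ∘ f) ≈ c ∘ f
  pullˡ p = trans sym-assoc (p ⟩∘⟨refl)

  pushˡ : ∀ {a : Hom B C} {b : Hom A B} {c : Hom A C} {f : Hom X A} →
          c ≈ a ∘ b → c ∘ f ≈ a ∘ (b ∘ f)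
  pushˡ p = sym (pullˡ (sym p))

  extendʳ : ∀ {a : Hom B C} {b : Hom A B} {c : Hom D C} {d : Hom A D} {f : Hom X A} →
            a ∘ b ≈ c ∘ d → a ∘ (b ∘ f) ≈ c ∘ (d ∘ f)
  extendʳ p = trans (pullˡ p) assoc

  cancelˡ : ∀ {a : Hom B A} {b : Hom A B} {f : Hom X A} → a ∘ b ≈ id → a ∘ (b ∘ f) ≈ f
  cancelˡ p = trans (pullˡ p) identityˡ

  cancelʳ : ∀ {a : Hom B A} {b : Hom A B} {f : Hom A X} → a ∘ b ≈ id → (f ∘ a) ∘ b ≈ f
  cancelʳ p = trans assoc (trans (refl⟩∘⟨ p) identityʳ)

  split-epi-cancel : ∀ {a : Hom A B} {s : Hom B A} {f g : Hom B C} →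
                     a ∘ s ≈ id → f ∘ a ≈ g ∘ a → f ≈ g
  split-epi-cancel {a = a} {s} {f} {g} as≈id fa≈ga = begin
    f              ≈⟨ cancelʳ as≈id ⟨
    (f ∘ a) ∘ s    ≈⟨ fa≈ga ⟩∘⟨refl ⟩
    (g ∘ a) ∘ s    ≈⟨ cancelʳ as≈id ⟩
    g              ∎

  inverse-unique : ∀ {p q : Hom A B} {p′ q′ : Hom B A} →
                   p ≈ q → p′ ∘ p ≈ id → q ∘ q′ ≈ id → p′ ≈ q′
  inverse-unique {p = p} {q} {p′} {q′} p≈q left right = begin
    p′             ≈⟨ identityʳ ⟨
    p′ ∘ id        ≈⟨ refl⟩∘⟨ right ⟨
    p′ ∘ (q ∘ q′)  ≈⟨ refl⟩∘⟨ p≈q ⟩∘⟨refl ⟨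
    p′ ∘ (p ∘ q′)  ≈⟨ cancelˡ left ⟩
    q′             ∎

  conjugate : ∀ {A′ B′} {i : Hom A B} {j : Hom B A} {x : Hom B B′} {y : Hom A A′}
                {i′ : Hom A′ B′} {j′ : Hom B′ A′} →
              j′ ∘ i′ ≈ id → i ∘ j ≈ id → x ∘ i ≈ i′ ∘ y → j′ ∘ x ≈ y ∘ j
  conjugate {i = i} {j} {x} {y} {i′} {j′} left right square = begin
    j′ ∘ x                ≈⟨ refl⟩∘⟨ identityʳ ⟨
    j′ ∘ (x ∘ id)         ≈⟨ refl⟩∘⟨ refl⟩∘⟨ right ⟨
    j′ ∘ (x ∘ (i ∘ j))    ≈⟨ refl⟩∘⟨ pullˡ square ⟩
    j′ ∘ ((i′ ∘ y) ∘ j)   ≈⟨ refl⟩∘⟨ assoc ⟩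
    j′ ∘ (i′ ∘ (y ∘ j))   ≈⟨ cancelˡ left ⟩
    y ∘ j                 ∎

module CoKleisliLifting {o ℓ e} (𝒞 : Category o ℓ e) where
  open Category 𝒞
  open HomReasoning 𝒞

  module _ {T₀ : Obj → Obj} {T₁ : ∀ {A B} → Hom A B → Hom (T₀ A) (T₀ B)}
           (T : IsComonad Obj Hom _≈_ id _∘_ T₀ T₁)
           {S₀ : Obj → Obj} {S₁ : ∀ {A B} → Hom A B → Hom (S₀ A) (S₀ B)}
           (S : IsComonad Obj Hom _≈_ id _∘_ S₀ S₁) where
    private
      module T = IsComonad T
      module S = IsComonad S

    record DistributiveLaw : Set (o ⊔ ℓ ⊔ e) where
      field
        β          : ∀ {A} → Hom (T₀ (S₀ A)) (S₀ (T₀ A))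
        β-natural  : ∀ {A B} {f : Hom A B} → S₁ (T₁ f) ∘ β ≈ β ∘ T₁ (S₁ f)
        β-εᵀ       : ∀ {A} → S₁ (T.ε A) ∘ β ≈ T.ε (S₀ A)
        β-δᵀ       : ∀ {A} → S₁ (T.δ A) ∘ β ≈ β ∘ (T₁ β ∘ T.δ (S₀ A))
        β-εˢ       : ∀ {A} → S.ε (T₀ A) ∘ β ≈ T₁ (S.ε A)
        β-δˢ       : ∀ {A} → S.δ (T₀ A) ∘ β ≈ S₁ β ∘ (β ∘ T₁ (S.δ A))

    module _ (law : DistributiveLaw)
             {F₁ : ∀ {A B} → Hom (T₀ A) B → Hom (T₀ (S₀ A)) (S₀ B)}
             (F₁≈ : ∀ {A B} {f : Hom (T₀ A) B} → F₁ f ≈ S₁ f ∘ DistributiveLaw.β law)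
             where
      open DistributiveLaw law

      T₁-counitʳ : ∀ {A B} {h : Hom A B} → T₁ (h ∘ T.ε A) ∘ T.δ A ≈ T₁ h
      T₁-counitʳ = trans (T.F-homomorphism ⟩∘⟨refl) (cancelʳ T.counitʳ)

      εᵀ-extend : ∀ {A B} {h : Hom (T₀ A) B} → T.ε B ∘ (T₁ h ∘ T.δ A) ≈ h
      εᵀ-extend = trans (pullˡ (sym T.ε-natural)) (trans assoc (trans (refl⟩∘⟨ T.counitˡ) identityʳ))

      coKleisli-lift : IsComonad Obj (λ A B → Hom (T₀ A) B) _≈_ (λ {A} → T.ε A)
                                 (λ g f → g ∘ (T₁ f ∘ T.δ _)) S₀ F₁
      coKleisli-lift = record
        { F-resp-≈       = λ p → trans F₁≈ (trans (S.F-resp-≈ p ⟩∘⟨refl) (sym F₁≈))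
        ; F-identity     = trans F₁≈ β-εᵀ
        ; F-homomorphism = homomorphism
        ; ε              = λ A → S.ε A ∘ T.ε (S₀ A)
        ; δ              = λ A → S.δ A ∘ T.ε (S₀ A)
        ; ε-natural      = ε-natural
        ; δ-natural      = δ-natural
        ; counitˡ        = trans assoc (trans (refl⟩∘⟨ εᵀ-extend) (trans (pullˡ S.counitˡ) identityˡ))
        ; counitʳ        = counitʳ
        ; coassoc        = coassoc
        }
        where
        homomorphism : ∀ {A B C} {f : Hom (T₀ A) B} {g : Hom (T₀ B) C} →
                       F₁ (g ∘ (T₁ f ∘ T.δ A)) ≈ F₁ g ∘ (T₁ (F₁ f) ∘ T.δ (S₀ A))
        homomorphism {A} {f = f} {g} = begin
          F₁ (g ∘ (T₁ f ∘ T.δ A))                       ≈⟨ F₁≈ ⟩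
          S₁ (g ∘ (T₁ f ∘ T.δ A)) ∘ β                   ≈⟨ trans S.F-homomorphism (refl⟩∘⟨ S.F-homomorphism) ⟩∘⟨refl ⟩
          (S₁ g ∘ (S₁ (T₁ f) ∘ S₁ (T.δ A))) ∘ β         ≈⟨ assoc²′ ⟩
          S₁ g ∘ (S₁ (T₁ f) ∘ (S₁ (T.δ A) ∘ β))         ≈⟨ refl⟩∘⟨ refl⟩∘⟨ β-δᵀ ⟩
          S₁ g ∘ (S₁ (T₁ f) ∘ (β ∘ (T₁ β ∘ T.δ (S₀ A)))) ≈⟨ refl⟩∘⟨ pullˡ β-natural ⟩
          S₁ g ∘ ((β ∘ T₁ (S₁ f)) ∘ (T₁ β ∘ T.δ (S₀ A))) ≈⟨ refl⟩∘⟨ trans assoc (refl⟩∘⟨ pullˡ (sym T.F-homomorphism)) ⟩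
          S₁ g ∘ (β ∘ (T₁ (S₁ f ∘ β) ∘ T.δ (S₀ A)))     ≈⟨ sym-assoc ⟩
          (S₁ g ∘ β) ∘ (T₁ (S₁ f ∘ β) ∘ T.δ (S₀ A))     ≈⟨ sym F₁≈ ⟩∘⟨ T.F-resp-≈ (sym F₁≈) ⟩∘⟨refl ⟩
          F₁ g ∘ (T₁ (F₁ f) ∘ T.δ (S₀ A))               ∎

        ε-natural : ∀ {A B} {f : Hom (T₀ A) B} →
                    f ∘ (T₁ (S.ε A ∘ T.ε (S₀ A)) ∘ T.δ (S₀ A)) ≈ (S.ε B ∘ T.ε (S₀ B)) ∘ (T₁ (F₁ f) ∘ T.δ (S₀ A))
        ε-natural {A} {B} {f} = begin
          f ∘ (T₁ (S.ε A ∘ T.ε (S₀ A)) ∘ T.δ (S₀ A))      ≈⟨ refl⟩∘⟨ T₁-counitʳ ⟩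
          f ∘ T₁ (S.ε A)                                  ≈⟨ refl⟩∘⟨ β-εˢ ⟨
          f ∘ (S.ε (T₀ A) ∘ β)                            ≈⟨ pullˡ S.ε-natural ⟩
          (S.ε B ∘ S₁ f) ∘ β                              ≈⟨ trans assoc (refl⟩∘⟨ sym F₁≈) ⟩
          S.ε B ∘ F₁ f                                    ≈⟨ refl⟩∘⟨ εᵀ-extend ⟨
          S.ε B ∘ (T.ε (S₀ B) ∘ (T₁ (F₁ f) ∘ T.δ (S₀ A))) ≈⟨ sym-assoc ⟩
          (S.ε B ∘ T.ε (S₀ B)) ∘ (T₁ (F₁ f) ∘ T.δ (S₀ A)) ∎

        δ-natural : ∀ {A B} {f : Hom (T₀ A) B} →
                    F₁ (F₁ f) ∘ (T₁ (S.δ A ∘ T.ε (S₀ A)) ∘ T.δ (S₀ A)) ≈ (S.δ B ∘ T.ε (S₀ B)) ∘ (T₁ (F₁ f) ∘ T.δ (S₀ A))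
        δ-natural {A} {B} {f} = begin
          F₁ (F₁ f) ∘ (T₁ (S.δ A ∘ T.ε (S₀ A)) ∘ T.δ (S₀ A)) ≈⟨ refl⟩∘⟨ T₁-counitʳ ⟩
          F₁ (F₁ f) ∘ T₁ (S.δ A)                           ≈⟨ trans F₁≈ (trans (S.F-resp-≈ F₁≈) S.F-homomorphism ⟩∘⟨refl) ⟩∘⟨refl ⟩
          ((S₁ (S₁ f) ∘ S₁ β) ∘ β) ∘ T₁ (S.δ A)            ≈⟨ trans assoc (trans assoc (refl⟩∘⟨ sym β-δˢ)) ⟩
          S₁ (S₁ f) ∘ (S.δ (T₀ A) ∘ β)                     ≈⟨ pullˡ S.δ-natural ⟩
          (S.δ B ∘ S₁ f) ∘ β                               ≈⟨ trans assoc (refl⟩∘⟨ sym F₁≈) ⟩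
          S.δ B ∘ F₁ f                                     ≈⟨ refl⟩∘⟨ εᵀ-extend ⟨
          S.δ B ∘ (T.ε (S₀ B) ∘ (T₁ (F₁ f) ∘ T.δ (S₀ A)))  ≈⟨ sym-assoc ⟩
          (S.δ B ∘ T.ε (S₀ B)) ∘ (T₁ (F₁ f) ∘ T.δ (S₀ A))  ∎

        counitʳ : ∀ {A} → F₁ (S.ε A ∘ T.ε (S₀ A)) ∘ (T₁ (S.δ A ∘ T.ε (S₀ A)) ∘ T.δ (S₀ A)) ≈ T.ε (S₀ A)
        counitʳ {A} = begin
          F₁ (S.ε A ∘ T.ε (S₀ A)) ∘ (T₁ (S.δ A ∘ T.ε (S₀ A)) ∘ T.δ (S₀ A)) ≈⟨ refl⟩∘⟨ T₁-counitʳ ⟩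
          F₁ (S.ε A ∘ T.ε (S₀ A)) ∘ T₁ (S.δ A)                 ≈⟨ trans F₁≈ (S.F-homomorphism ⟩∘⟨refl) ⟩∘⟨refl ⟩
          ((S₁ (S.ε A) ∘ S₁ (T.ε (S₀ A))) ∘ β) ∘ T₁ (S.δ A)    ≈⟨ trans assoc (trans assoc (refl⟩∘⟨ pullˡ β-εᵀ)) ⟩
          S₁ (S.ε A) ∘ (T.ε (S₀ (S₀ A)) ∘ T₁ (S.δ A))          ≈⟨ refl⟩∘⟨ T.ε-natural ⟨
          S₁ (S.ε A) ∘ (S.δ A ∘ T.ε (S₀ A))                    ≈⟨ cancelˡ S.counitʳ ⟩
          T.ε (S₀ A)                                           ∎

        coassoc : ∀ {A} → (S.δ (S₀ A) ∘ T.ε (S₀ (S₀ A))) ∘ (T₁ (S.δ A ∘ T.ε (S₀ A)) ∘ T.δ (S₀ A))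
                          ≈ F₁ (S.δ A ∘ T.ε (S₀ A)) ∘ (T₁ (S.δ A ∘ T.ε (S₀ A)) ∘ T.δ (S₀ A))
        coassoc {A} = begin
          (S.δ (S₀ A) ∘ T.ε (S₀ (S₀ A))) ∘ (T₁ (S.δ A ∘ T.ε (S₀ A)) ∘ T.δ (S₀ A)) ≈⟨ trans assoc (refl⟩∘⟨ εᵀ-extend) ⟩
          S.δ (S₀ A) ∘ (S.δ A ∘ T.ε (S₀ A))                          ≈⟨ pullˡ S.coassoc ⟩
          (S₁ (S.δ A) ∘ S.δ A) ∘ T.ε (S₀ A)                          ≈⟨ trans assoc (refl⟩∘⟨ T.ε-natural) ⟩
          S₁ (S.δ A) ∘ (T.ε (S₀ (S₀ A)) ∘ T₁ (S.δ A))                ≈⟨ refl⟩∘⟨ sym β-εᵀ ⟩∘⟨refl ⟩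
          S₁ (S.δ A) ∘ ((S₁ (T.ε (S₀ A)) ∘ β) ∘ T₁ (S.δ A))          ≈⟨ trans (refl⟩∘⟨ assoc) (trans sym-assoc sym-assoc) ⟩
          ((S₁ (S.δ A) ∘ S₁ (T.ε (S₀ A))) ∘ β) ∘ T₁ (S.δ A)          ≈⟨ trans (sym S.F-homomorphism ⟩∘⟨refl) (sym F₁≈) ⟩∘⟨refl ⟩
          F₁ (S.δ A ∘ T.ε (S₀ A)) ∘ T₁ (S.δ A)                       ≈⟨ refl⟩∘⟨ T₁-counitʳ ⟨
          F₁ (S.δ A ∘ T.ε (S₀ A)) ∘ (T₁ (S.δ A ∘ T.ε (S₀ A)) ∘ T.δ (S₀ A)) ∎

module MonoidalReasoning {o ℓ e} (𝒞 : SymmetricMonoidalCategory o ℓ e) where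
  open SymmetricMonoidalCategory 𝒞
  open HomReasoning cat public

  private variable
    A B C D X Y Z : Obj

  infixr 4 _⟩⊗⟨_ refl⟩⊗⟨_
  infixl 5 _⟩⊗⟨refl

  _⟩⊗⟨_ : ∀ {f f′ : Hom A B} {g g′ : Hom C D} → f ≈ f′ → g ≈ g′ → f ⊗₁ g ≈ f′ ⊗₁ g′
  _⟩⊗⟨_ = ⊗-resp-≈

  refl⟩⊗⟨_ : ∀ {f : Hom A B} {g g′ : Hom C D} → g ≈ g′ → f ⊗₁ g ≈ f ⊗₁ g′
  refl⟩⊗⟨ p = refl ⟩⊗⟨ p

  _⟩⊗⟨refl : ∀ {f f′ : Hom A B} {g : Hom C D} → f ≈ f′ → f ⊗₁ g ≈ f′ ⊗₁ g
  p ⟩⊗⟨refl = p ⟩⊗⟨ refl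

  ⊗-merge : ∀ {f : Hom B C} {h : Hom A B} {g : Hom Y Z} {k : Hom X Y} →
            (f ⊗₁ g) ∘ (h ⊗₁ k) ≈ (f ∘ h) ⊗₁ (g ∘ k)
  ⊗-merge = sym ⊗-homomorphism

  id⊗-merge : ∀ {g : Hom Y Z} {k : Hom X Y} → (id {A} ⊗₁ g) ∘ (id ⊗₁ k) ≈ id ⊗₁ (g ∘ k)
  id⊗-merge = trans ⊗-merge (identityˡ ⟩⊗⟨refl)

  ⊗id-merge : ∀ {g : Hom Y Z} {k : Hom X Y} → (g ⊗₁ id {A}) ∘ (k ⊗₁ id) ≈ (g ∘ k) ⊗₁ id
  ⊗id-merge = trans ⊗-merge (refl⟩⊗⟨ identityˡ)

  ⊗id-split₃ : ∀ {a : Hom C D} {b : Hom B C} {c : Hom A B} →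
               (a ∘ (b ∘ c)) ⊗₁ id {X} ≈ (a ⊗₁ id) ∘ ((b ⊗₁ id) ∘ (c ⊗₁ id))
  ⊗id-split₃ = trans (sym ⊗id-merge) (refl⟩∘⟨ sym ⊗id-merge)

  id⊗-merge₅ : ∀ {A₁ A₂ A₃ A₄ A₅ A₆} {a : Hom A₅ A₆} {b : Hom A₄ A₅} {c : Hom A₃ A₄}
                 {d : Hom A₂ A₃} {e′ : Hom A₁ A₂} {f : Hom X (A ⊗₀ A₁)} →
               (id ⊗₁ a) ∘ ((id ⊗₁ b) ∘ ((id ⊗₁ c) ∘ ((id ⊗₁ d) ∘ ((id ⊗₁ e′) ∘ f))))
               ≈ (id ⊗₁ (a ∘ (b ∘ (c ∘ (d ∘ e′))))) ∘ f
  id⊗-merge₅ = trans (refl⟩∘⟨ refl⟩∘⟨ refl⟩∘⟨ pullˡ id⊗-merge)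
              (trans (refl⟩∘⟨ refl⟩∘⟨ pullˡ id⊗-merge)
              (trans (refl⟩∘⟨ pullˡ id⊗-merge) (pullˡ id⊗-merge)))

  id⊗-inverse : ∀ {a : Hom Y X} {b : Hom X Y} → a ∘ b ≈ id → (id {A} ⊗₁ a) ∘ (id ⊗₁ b) ≈ id
  id⊗-inverse p = trans id⊗-merge (trans (refl⟩⊗⟨ p) ⊗-identity)

  ⊗id-inverse : ∀ {a : Hom Y X} {b : Hom X Y} → a ∘ b ≈ id → (a ⊗₁ id {A}) ∘ (b ⊗₁ id) ≈ id
  ⊗id-inverse p = trans ⊗id-merge (trans (p ⟩⊗⟨refl) ⊗-identity)

  serialize₁₂ : ∀ {f : Hom A B} {g : Hom C D} → f ⊗₁ g ≈ (f ⊗₁ id) ∘ (id ⊗₁ g)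
  serialize₁₂ = trans (sym identityʳ ⟩⊗⟨ sym identityˡ) ⊗-homomorphism

  serialize₂₁ : ∀ {f : Hom A B} {g : Hom C D} → f ⊗₁ g ≈ (id ⊗₁ g) ∘ (f ⊗₁ id)
  serialize₂₁ = trans (sym identityˡ ⟩⊗⟨ sym identityʳ) ⊗-homomorphism

  ⊗id-id⊗-commute : ∀ {f : Hom A B} {g : Hom C D} → (f ⊗₁ id) ∘ (id ⊗₁ g) ≈ (id ⊗₁ g) ∘ (f ⊗₁ id)
  ⊗id-id⊗-commute = trans (sym serialize₁₂) serialize₂₁

  α⇐-natural : ∀ {A′ B′ C′} {f : Hom A A′} {g : Hom B B′} {h : Hom C C′} →
               α⇐ ∘ (f ⊗₁ (g ⊗₁ h)) ≈ ((f ⊗₁ g) ⊗₁ h) ∘ α⇐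
  α⇐-natural = conjugate α-isoˡ α-isoʳ α-natural

  id⊗-α⇐ : ∀ {h : Hom C D} → (id {X ⊗₀ Y} ⊗₁ h) ∘ α⇐ ≈ α⇐ ∘ (id ⊗₁ (id ⊗₁ h))
  id⊗-α⇐ = trans (sym ⊗-identity ⟩⊗⟨refl ⟩∘⟨refl) (sym α⇐-natural)

  id⊗id⊗-α⇒ : ∀ {h : Hom C D} → (id {X} ⊗₁ (id {Y} ⊗₁ h)) ∘ α⇒ ≈ α⇒ ∘ (id ⊗₁ h)
  id⊗id⊗-α⇒ = trans α-natural (refl⟩∘⟨ ⊗-identity ⟩⊗⟨refl)

  pentagon-inv : (α⇐ {A} {B} {C} ⊗₁ id {D}) ∘ (α⇐ ∘ (id ⊗₁ α⇐)) ≈ α⇐ ∘ α⇐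
  pentagon-inv = inverse-unique pentagon left right
    where
    left : ((α⇐ ⊗₁ id) ∘ (α⇐ ∘ (id ⊗₁ α⇐))) ∘ ((id ⊗₁ α⇒) ∘ (α⇒ ∘ (α⇒ ⊗₁ id))) ≈ id {((A ⊗₀ B) ⊗₀ C) ⊗₀ D}
    left = begin
      ((α⇐ ⊗₁ id) ∘ (α⇐ ∘ (id ⊗₁ α⇐))) ∘ ((id ⊗₁ α⇒) ∘ (α⇒ ∘ (α⇒ ⊗₁ id))) ≈⟨ assoc²′ ⟩
      (α⇐ ⊗₁ id) ∘ (α⇐ ∘ ((id ⊗₁ α⇐) ∘ ((id ⊗₁ α⇒) ∘ (α⇒ ∘ (α⇒ ⊗₁ id))))) ≈⟨ refl⟩∘⟨ refl⟩∘⟨ cancelˡ (id⊗-inverse α-isoˡ) ⟩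
      (α⇐ ⊗₁ id) ∘ (α⇐ ∘ (α⇒ ∘ (α⇒ ⊗₁ id)))                               ≈⟨ refl⟩∘⟨ cancelˡ α-isoˡ ⟩
      (α⇐ ⊗₁ id) ∘ (α⇒ ⊗₁ id)                                             ≈⟨ ⊗id-inverse α-isoˡ ⟩
      id                                                                  ∎
    right : (α⇒ ∘ α⇒) ∘ (α⇐ ∘ α⇐) ≈ id {A ⊗₀ (B ⊗₀ (C ⊗₀ D))}
    right = trans assoc (trans (refl⟩∘⟨ cancelˡ α-isoʳ) α-isoʳ)

  pentagon-α⇒∘α⇐⊗id : α⇒ {A ⊗₀ B} {C} {D} ∘ (α⇐ {A} {B} {C} ⊗₁ id) ≈ α⇐ ∘ ((id ⊗₁ α⇒) ∘ α⇒)
  pentagon-α⇒∘α⇐⊗id = begin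
    α⇒ ∘ (α⇐ ⊗₁ id)                                            ≈⟨ cancelˡ α-isoˡ ⟨
    α⇐ ∘ (α⇒ ∘ (α⇒ ∘ (α⇐ ⊗₁ id)))                              ≈⟨ refl⟩∘⟨ pullˡ (sym pentagon) ⟩
    α⇐ ∘ (((id ⊗₁ α⇒) ∘ (α⇒ ∘ (α⇒ ⊗₁ id))) ∘ (α⇐ ⊗₁ id))       ≈⟨ refl⟩∘⟨ assoc²′ ⟩
    α⇐ ∘ ((id ⊗₁ α⇒) ∘ (α⇒ ∘ ((α⇒ ⊗₁ id) ∘ (α⇐ ⊗₁ id))))       ≈⟨ refl⟩∘⟨ refl⟩∘⟨ refl⟩∘⟨ ⊗id-inverse α-isoʳ ⟩
    α⇐ ∘ ((id ⊗₁ α⇒) ∘ (α⇒ ∘ id))                              ≈⟨ refl⟩∘⟨ refl⟩∘⟨ identityʳ ⟩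
    α⇐ ∘ ((id ⊗₁ α⇒) ∘ α⇒)                                     ∎

  pentagon-α⇒∘α⇒⊗id∘α⇐ : α⇒ {A} {B ⊗₀ C} {D} ∘ ((α⇒ ⊗₁ id) ∘ α⇐) ≈ (id ⊗₁ α⇐) ∘ α⇒
  pentagon-α⇒∘α⇒⊗id∘α⇐ = begin
    α⇒ ∘ ((α⇒ ⊗₁ id) ∘ α⇐)                                    ≈⟨ cancelˡ (id⊗-inverse α-isoˡ) ⟨
    (id ⊗₁ α⇐) ∘ ((id ⊗₁ α⇒) ∘ (α⇒ ∘ ((α⇒ ⊗₁ id) ∘ α⇐)))      ≈⟨ refl⟩∘⟨ trans (refl⟩∘⟨ sym-assoc) (pullˡ pentagon) ⟩
    (id ⊗₁ α⇐) ∘ ((α⇒ ∘ α⇒) ∘ α⇐)                             ≈⟨ refl⟩∘⟨ cancelʳ α-isoʳ ⟩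
    (id ⊗₁ α⇐) ∘ α⇒                                           ∎

  pentagon-α⇐⊗id∘α⇐ : (α⇐ {A} {B} {C} ⊗₁ id {D}) ∘ α⇐ ≈ α⇐ ∘ (α⇐ ∘ (id ⊗₁ α⇒))
  pentagon-α⇐⊗id∘α⇐ = begin
    (α⇐ ⊗₁ id) ∘ α⇐                                           ≈⟨ identityʳ ⟨
    ((α⇐ ⊗₁ id) ∘ α⇐) ∘ id                                    ≈⟨ refl⟩∘⟨ id⊗-inverse α-isoˡ ⟨
    ((α⇐ ⊗₁ id) ∘ α⇐) ∘ ((id ⊗₁ α⇐) ∘ (id ⊗₁ α⇒))             ≈⟨ trans assoc (trans (refl⟩∘⟨ sym-assoc) sym-assoc) ⟩
    ((α⇐ ⊗₁ id) ∘ (α⇐ ∘ (id ⊗₁ α⇐))) ∘ (id ⊗₁ α⇒)             ≈⟨ pentagon-inv ⟩∘⟨refl ⟩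
    (α⇐ ∘ α⇐) ∘ (id ⊗₁ α⇒)                                    ≈⟨ assoc ⟩
    α⇐ ∘ (α⇐ ∘ (id ⊗₁ α⇒))                                    ∎

  triangle-inv : (ρ⇒ {A} ⊗₁ id) ∘ α⇐ ≈ id ⊗₁ λ⇒ {B}
  triangle-inv = trans (sym triangle ⟩∘⟨refl) (cancelʳ α-isoʳ)

  ⊗I-faithful : ∀ {f g : Hom A B} → f ⊗₁ id {I} ≈ g ⊗₁ id → f ≈ g
  ⊗I-faithful {f = f} {g} p = begin
    f                  ≈⟨ cancelʳ ρ-isoʳ ⟨
    (f ∘ ρ⇒) ∘ ρ⇐      ≈⟨ trans ρ-natural (refl⟩∘⟨ p) ⟩∘⟨refl ⟩
    (ρ⇒ ∘ (g ⊗₁ id)) ∘ ρ⇐ ≈⟨ sym ρ-natural ⟩∘⟨refl ⟩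
    (g ∘ ρ⇒) ∘ ρ⇐      ≈⟨ cancelʳ ρ-isoʳ ⟩
    g                  ∎

  I⊗-faithful : ∀ {f g : Hom A B} → id {I} ⊗₁ f ≈ id ⊗₁ g → f ≈ g
  I⊗-faithful {f = f} {g} p = begin
    f                  ≈⟨ cancelʳ λ-isoʳ ⟨
    (f ∘ λ⇒) ∘ λ⇐      ≈⟨ trans λ-natural (refl⟩∘⟨ p) ⟩∘⟨refl ⟩
    (λ⇒ ∘ (id ⊗₁ g)) ∘ λ⇐ ≈⟨ sym λ-natural ⟩∘⟨refl ⟩
    (g ∘ λ⇒) ∘ λ⇐      ≈⟨ cancelʳ λ-isoʳ ⟩
    g                  ∎

  coherence₂ : (id {A} ⊗₁ ρ⇒ {B}) ∘ α⇒ ≈ ρ⇒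
  coherence₂ = ⊗I-faithful (begin
    ((id ⊗₁ ρ⇒) ∘ α⇒) ⊗₁ id                                    ≈⟨ trans (refl⟩⊗⟨ sym identityˡ) ⊗-homomorphism ⟩
    ((id ⊗₁ ρ⇒) ⊗₁ id) ∘ (α⇒ ⊗₁ id)                            ≈⟨ sym (cancelʳ α-isoˡ) ⟩∘⟨refl ⟩
    ((((id ⊗₁ ρ⇒) ⊗₁ id) ∘ α⇐) ∘ α⇒) ∘ (α⇒ ⊗₁ id)              ≈⟨ sym α⇐-natural ⟩∘⟨refl ⟩∘⟨refl ⟩
    ((α⇐ ∘ (id ⊗₁ (ρ⇒ ⊗₁ id))) ∘ α⇒) ∘ (α⇒ ⊗₁ id)              ≈⟨ trans assoc assoc ⟩
    α⇐ ∘ ((id ⊗₁ (ρ⇒ ⊗₁ id)) ∘ (α⇒ ∘ (α⇒ ⊗₁ id)))              ≈⟨ refl⟩∘⟨ (refl⟩⊗⟨ sym triangle) ⟩∘⟨refl ⟩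
    α⇐ ∘ ((id ⊗₁ ((id ⊗₁ λ⇒) ∘ α⇒)) ∘ (α⇒ ∘ (α⇒ ⊗₁ id)))       ≈⟨ refl⟩∘⟨ pushˡ (sym id⊗-merge) ⟩
    α⇐ ∘ ((id ⊗₁ (id ⊗₁ λ⇒)) ∘ ((id ⊗₁ α⇒) ∘ (α⇒ ∘ (α⇒ ⊗₁ id)))) ≈⟨ refl⟩∘⟨ refl⟩∘⟨ pentagon ⟩
    α⇐ ∘ ((id ⊗₁ (id ⊗₁ λ⇒)) ∘ (α⇒ ∘ α⇒))                     ≈⟨ refl⟩∘⟨ extendʳ id⊗id⊗-α⇒ ⟩
    α⇐ ∘ (α⇒ ∘ ((id ⊗₁ λ⇒) ∘ α⇒))                             ≈⟨ cancelˡ α-isoˡ ⟩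
    (id ⊗₁ λ⇒) ∘ α⇒                                           ≈⟨ triangle ⟩
    ρ⇒ ⊗₁ id                                                  ∎)

  coherence₂-inv : ρ⇒ ∘ α⇐ ≈ id {A} ⊗₁ ρ⇒ {B}
  coherence₂-inv = trans (sym coherence₂ ⟩∘⟨refl) (cancelʳ α-isoʳ)

  braiding-coherence : λ⇒ ∘ σ {A} {I} ≈ ρ⇒
  braiding-coherence = sym (I⊗-faithful (split-epi-cancel α⇒∘σ⊗id-retraction (begin
    (id ⊗₁ ρ⇒) ∘ (α⇒ ∘ (σ ⊗₁ id))              ≈⟨ pullˡ coherence₂ ⟩
    ρ⇒ ∘ (σ ⊗₁ id)                             ≈⟨ ρ-natural ⟨
    σ ∘ ρ⇒                                     ≈⟨ refl⟩∘⟨ coherence₂ ⟨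
    σ ∘ ((id ⊗₁ ρ⇒) ∘ α⇒)                      ≈⟨ extendʳ (sym σ-natural) ⟩
    (ρ⇒ ⊗₁ id) ∘ (σ ∘ α⇒)                      ≈⟨ pushˡ (sym triangle) ⟩
    (id ⊗₁ λ⇒) ∘ (α⇒ ∘ (σ ∘ α⇒))               ≈⟨ refl⟩∘⟨ hexagon ⟩
    (id ⊗₁ λ⇒) ∘ ((id ⊗₁ σ) ∘ (α⇒ ∘ (σ ⊗₁ id))) ≈⟨ pullˡ id⊗-merge ⟩
    (id ⊗₁ (λ⇒ ∘ σ)) ∘ (α⇒ ∘ (σ ⊗₁ id))        ∎)))
    where
    α⇒∘σ⊗id-retraction : (α⇒ ∘ (σ ⊗₁ id)) ∘ ((σ ⊗₁ id) ∘ α⇐) ≈ id {I ⊗₀ (A ⊗₀ I)}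
    α⇒∘σ⊗id-retraction = trans assoc (trans (refl⟩∘⟨ cancelˡ (⊗id-inverse σ-involutive)) α-isoʳ)

  braiding-coherence′ : ρ⇒ ∘ σ {I} {A} ≈ λ⇒
  braiding-coherence′ = trans (sym braiding-coherence ⟩∘⟨refl) (trans assoc (trans (refl⟩∘⟨ σ-involutive) identityʳ))

  braiding-⊗ʳ : σ {A} {B ⊗₀ C} ≈ α⇐ ∘ ((id ⊗₁ σ) ∘ (α⇒ ∘ ((σ ⊗₁ id) ∘ α⇐)))
  braiding-⊗ʳ = begin
    σ                                                 ≈⟨ cancelˡ α-isoˡ ⟨
    α⇐ ∘ (α⇒ ∘ σ)                                     ≈⟨ refl⟩∘⟨ cancelʳ α-isoʳ ⟨
    α⇐ ∘ (((α⇒ ∘ σ) ∘ α⇒) ∘ α⇐)                       ≈⟨ refl⟩∘⟨ trans assoc hexagon ⟩∘⟨refl ⟩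
    α⇐ ∘ (((id ⊗₁ σ) ∘ (α⇒ ∘ (σ ⊗₁ id))) ∘ α⇐)        ≈⟨ refl⟩∘⟨ assoc²′ ⟩
    α⇐ ∘ ((id ⊗₁ σ) ∘ (α⇒ ∘ ((σ ⊗₁ id) ∘ α⇐)))        ∎

  braiding-⊗ˡ : σ {B ⊗₀ C} {A} ≈ α⇒ ∘ ((σ ⊗₁ id) ∘ (α⇐ ∘ ((id ⊗₁ σ) ∘ α⇒)))
  braiding-⊗ˡ = inverse-unique braiding-⊗ʳ σ-involutive (begin
    (α⇐ ∘ ((id ⊗₁ σ) ∘ (α⇒ ∘ ((σ ⊗₁ id) ∘ α⇐)))) ∘ (α⇒ ∘ ((σ ⊗₁ id) ∘ (α⇐ ∘ ((id ⊗₁ σ) ∘ α⇒))))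
      ≈⟨ trans assoc²′ (refl⟩∘⟨ refl⟩∘⟨ assoc²′) ⟩
    α⇐ ∘ ((id ⊗₁ σ) ∘ (α⇒ ∘ ((σ ⊗₁ id) ∘ (α⇐ ∘ (α⇒ ∘ ((σ ⊗₁ id) ∘ (α⇐ ∘ ((id ⊗₁ σ) ∘ α⇒))))))))
      ≈⟨ refl⟩∘⟨ refl⟩∘⟨ refl⟩∘⟨ refl⟩∘⟨ cancelˡ α-isoˡ ⟩
    α⇐ ∘ ((id ⊗₁ σ) ∘ (α⇒ ∘ ((σ ⊗₁ id) ∘ ((σ ⊗₁ id) ∘ (α⇐ ∘ ((id ⊗₁ σ) ∘ α⇒))))))
      ≈⟨ refl⟩∘⟨ refl⟩∘⟨ refl⟩∘⟨ cancelˡ (⊗id-inverse σ-involutive) ⟩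
    α⇐ ∘ ((id ⊗₁ σ) ∘ (α⇒ ∘ (α⇐ ∘ ((id ⊗₁ σ) ∘ α⇒))))
      ≈⟨ refl⟩∘⟨ refl⟩∘⟨ cancelˡ α-isoʳ ⟩
    α⇐ ∘ ((id ⊗₁ σ) ∘ ((id ⊗₁ σ) ∘ α⇒))
      ≈⟨ refl⟩∘⟨ cancelˡ (id⊗-inverse σ-involutive) ⟩
    α⇐ ∘ α⇒
      ≈⟨ α-isoˡ ⟩
    id ∎)

module Shuffles {o ℓ e} (𝒞 : SymmetricMonoidalCategory o ℓ e) where
  open SymmetricMonoidalCategory 𝒞
  open MonoidalReasoning 𝒞

  private variable
    A B C D X Y Z : Obj

  swap₂₃ : Hom ((A ⊗₀ X) ⊗₀ Y) ((A ⊗₀ Y) ⊗₀ X)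
  swap₂₃ = α⇐ ∘ ((id ⊗₁ σ) ∘ α⇒)

  swap₁₂ : Hom (X ⊗₀ (Y ⊗₀ Z)) (Y ⊗₀ (X ⊗₀ Z))
  swap₁₂ = α⇒ ∘ ((σ ⊗₁ id) ∘ α⇐)

  interchange₄ : Hom ((A ⊗₀ B) ⊗₀ (C ⊗₀ D)) ((A ⊗₀ C) ⊗₀ (B ⊗₀ D))
  interchange₄ = α⇐ ∘ ((id ⊗₁ swap₁₂) ∘ α⇒)

  swap₂₃-natural : ∀ {A′ X′ Y′} {f : Hom A A′} {g : Hom X X′} {h : Hom Y Y′} →
                   ((f ⊗₁ h) ⊗₁ g) ∘ swap₂₃ ≈ swap₂₃ ∘ ((f ⊗₁ g) ⊗₁ h)
  swap₂₃-natural {f = f} {g} {h} = begin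
    ((f ⊗₁ h) ⊗₁ g) ∘ (α⇐ ∘ ((id ⊗₁ σ) ∘ α⇒))    ≈⟨ extendʳ (sym α⇐-natural) ⟩
    α⇐ ∘ ((f ⊗₁ (h ⊗₁ g)) ∘ ((id ⊗₁ σ) ∘ α⇒))    ≈⟨ refl⟩∘⟨ extendʳ σ-square ⟩
    α⇐ ∘ ((id ⊗₁ σ) ∘ ((f ⊗₁ (g ⊗₁ h)) ∘ α⇒))    ≈⟨ refl⟩∘⟨ refl⟩∘⟨ α-natural ⟩
    α⇐ ∘ ((id ⊗₁ σ) ∘ (α⇒ ∘ ((f ⊗₁ g) ⊗₁ h)))    ≈⟨ sym assoc²′ ⟩
    (α⇐ ∘ ((id ⊗₁ σ) ∘ α⇒)) ∘ ((f ⊗₁ g) ⊗₁ h)    ∎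
    where
    σ-square : (f ⊗₁ (h ⊗₁ g)) ∘ (id ⊗₁ σ) ≈ (id ⊗₁ σ) ∘ (f ⊗₁ (g ⊗₁ h))
    σ-square = trans ⊗-merge (trans (trans identityʳ (sym identityˡ) ⟩⊗⟨ σ-natural) ⊗-homomorphism)

  swap₂₃-unit₃ : (ρ⇒ ⊗₁ id) ∘ swap₂₃ {A} {X} {I} ≈ ρ⇒
  swap₂₃-unit₃ = begin
    (ρ⇒ ⊗₁ id) ∘ (α⇐ ∘ ((id ⊗₁ σ) ∘ α⇒))   ≈⟨ pullˡ triangle-inv ⟩
    (id ⊗₁ λ⇒) ∘ ((id ⊗₁ σ) ∘ α⇒)          ≈⟨ pullˡ id⊗-merge ⟩
    (id ⊗₁ (λ⇒ ∘ σ)) ∘ α⇒                  ≈⟨ (refl⟩⊗⟨ braiding-coherence) ⟩∘⟨refl ⟩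
    (id ⊗₁ ρ⇒) ∘ α⇒                        ≈⟨ coherence₂ ⟩
    ρ⇒                                     ∎

  swap₂₃-unit₂ : ρ⇒ ∘ swap₂₃ {A} {I} {Y} ≈ ρ⇒ ⊗₁ id
  swap₂₃-unit₂ = begin
    ρ⇒ ∘ (α⇐ ∘ ((id ⊗₁ σ) ∘ α⇒))           ≈⟨ pullˡ coherence₂-inv ⟩
    (id ⊗₁ ρ⇒) ∘ ((id ⊗₁ σ) ∘ α⇒)          ≈⟨ pullˡ id⊗-merge ⟩
    (id ⊗₁ (ρ⇒ ∘ σ)) ∘ α⇒                  ≈⟨ (refl⟩⊗⟨ braiding-coherence′) ⟩∘⟨refl ⟩
    (id ⊗₁ λ⇒) ∘ α⇒                        ≈⟨ triangle ⟩
    ρ⇒ ⊗₁ id                               ∎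

  swap₂₃-⊗₃ : swap₂₃ {A ⊗₀ Y} {X} {Z} ∘ ((swap₂₃ ⊗₁ id) ∘ α⇐) ≈ (α⇐ ⊗₁ id) ∘ swap₂₃ {A} {X} {Y ⊗₀ Z}
  swap₂₃-⊗₃ = begin
    (α⇐ ∘ ((id ⊗₁ σ) ∘ α⇒)) ∘ (((α⇐ ∘ ((id ⊗₁ σ) ∘ α⇒)) ⊗₁ id) ∘ α⇐)
      ≈⟨ trans assoc²′ (refl⟩∘⟨ refl⟩∘⟨ refl⟩∘⟨ trans (⊗id-split₃ ⟩∘⟨refl) assoc²′) ⟩
    α⇐ ∘ ((id ⊗₁ σ) ∘ (α⇒ ∘ ((α⇐ ⊗₁ id) ∘ (((id ⊗₁ σ) ⊗₁ id) ∘ ((α⇒ ⊗₁ id) ∘ α⇐)))))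
      ≈⟨ refl⟩∘⟨ refl⟩∘⟨ trans (pullˡ pentagon-α⇒∘α⇐⊗id) assoc²′ ⟩
    α⇐ ∘ ((id ⊗₁ σ) ∘ (α⇐ ∘ ((id ⊗₁ α⇒) ∘ (α⇒ ∘ (((id ⊗₁ σ) ⊗₁ id) ∘ ((α⇒ ⊗₁ id) ∘ α⇐))))))
      ≈⟨ refl⟩∘⟨ refl⟩∘⟨ refl⟩∘⟨ refl⟩∘⟨ extendʳ (sym α-natural) ⟩
    α⇐ ∘ ((id ⊗₁ σ) ∘ (α⇐ ∘ ((id ⊗₁ α⇒) ∘ ((id ⊗₁ (σ ⊗₁ id)) ∘ (α⇒ ∘ ((α⇒ ⊗₁ id) ∘ α⇐))))))
      ≈⟨ refl⟩∘⟨ refl⟩∘⟨ refl⟩∘⟨ refl⟩∘⟨ refl⟩∘⟨ pentagon-α⇒∘α⇒⊗id∘α⇐ ⟩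
    α⇐ ∘ ((id ⊗₁ σ) ∘ (α⇐ ∘ ((id ⊗₁ α⇒) ∘ ((id ⊗₁ (σ ⊗₁ id)) ∘ ((id ⊗₁ α⇐) ∘ α⇒)))))
      ≈⟨ refl⟩∘⟨ extendʳ id⊗-α⇐ ⟩
    α⇐ ∘ (α⇐ ∘ ((id ⊗₁ (id ⊗₁ σ)) ∘ ((id ⊗₁ α⇒) ∘ ((id ⊗₁ (σ ⊗₁ id)) ∘ ((id ⊗₁ α⇐) ∘ α⇒)))))
      ≈⟨ trans (pullˡ (sym pentagon-inv)) assoc²′ ⟩
    (α⇐ ⊗₁ id) ∘ (α⇐ ∘ ((id ⊗₁ α⇐) ∘ ((id ⊗₁ (id ⊗₁ σ)) ∘ ((id ⊗₁ α⇒) ∘ ((id ⊗₁ (σ ⊗₁ id)) ∘ ((id ⊗₁ α⇐) ∘ α⇒))))))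
      ≈⟨ refl⟩∘⟨ refl⟩∘⟨ id⊗-merge₅ ⟩
    (α⇐ ⊗₁ id) ∘ (α⇐ ∘ ((id ⊗₁ (α⇐ ∘ ((id ⊗₁ σ) ∘ (α⇒ ∘ ((σ ⊗₁ id) ∘ α⇐))))) ∘ α⇒))
      ≈⟨ refl⟩∘⟨ refl⟩∘⟨ (refl⟩⊗⟨ sym braiding-⊗ʳ) ⟩∘⟨refl ⟩
    (α⇐ ⊗₁ id) ∘ (α⇐ ∘ ((id ⊗₁ σ) ∘ α⇒))
      ∎

  swap₂₃-⊗₂ : (swap₂₃ ⊗₁ id) ∘ (swap₂₃ {A ⊗₀ X} {Y} {Z} ∘ (α⇐ ⊗₁ id)) ≈ α⇐ ∘ swap₂₃ {A} {X ⊗₀ Y} {Z}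
  swap₂₃-⊗₂ = begin
    ((α⇐ ∘ ((id ⊗₁ σ) ∘ α⇒)) ⊗₁ id) ∘ ((α⇐ ∘ ((id ⊗₁ σ) ∘ α⇒)) ∘ (α⇐ ⊗₁ id))
      ≈⟨ ⊗id-split₃ ⟩∘⟨ assoc²′ ⟩
    ((α⇐ ⊗₁ id) ∘ (((id ⊗₁ σ) ⊗₁ id) ∘ (α⇒ ⊗₁ id))) ∘ (α⇐ ∘ ((id ⊗₁ σ) ∘ (α⇒ ∘ (α⇐ ⊗₁ id))))
      ≈⟨ assoc²′ ⟩
    (α⇐ ⊗₁ id) ∘ (((id ⊗₁ σ) ⊗₁ id) ∘ ((α⇒ ⊗₁ id) ∘ (α⇐ ∘ ((id ⊗₁ σ) ∘ (α⇒ ∘ (α⇐ ⊗₁ id))))))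
      ≈⟨ refl⟩∘⟨ refl⟩∘⟨ refl⟩∘⟨ refl⟩∘⟨ refl⟩∘⟨ pentagon-α⇒∘α⇐⊗id ⟩
    (α⇐ ⊗₁ id) ∘ (((id ⊗₁ σ) ⊗₁ id) ∘ ((α⇒ ⊗₁ id) ∘ (α⇐ ∘ ((id ⊗₁ σ) ∘ (α⇐ ∘ ((id ⊗₁ α⇒) ∘ α⇒))))))
      ≈⟨ refl⟩∘⟨ refl⟩∘⟨ refl⟩∘⟨ refl⟩∘⟨ extendʳ id⊗-α⇐ ⟩
    (α⇐ ⊗₁ id) ∘ (((id ⊗₁ σ) ⊗₁ id) ∘ ((α⇒ ⊗₁ id) ∘ (α⇐ ∘ (α⇐ ∘ ((id ⊗₁ (id ⊗₁ σ)) ∘ ((id ⊗₁ α⇒) ∘ α⇒))))))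
      ≈⟨ refl⟩∘⟨ refl⟩∘⟨ refl⟩∘⟨ trans (pullˡ (sym pentagon-inv)) assoc²′ ⟩
    (α⇐ ⊗₁ id) ∘ (((id ⊗₁ σ) ⊗₁ id) ∘ ((α⇒ ⊗₁ id) ∘ ((α⇐ ⊗₁ id) ∘ (α⇐ ∘ ((id ⊗₁ α⇐) ∘ ((id ⊗₁ (id ⊗₁ σ)) ∘ ((id ⊗₁ α⇒) ∘ α⇒)))))))
      ≈⟨ refl⟩∘⟨ refl⟩∘⟨ cancelˡ (⊗id-inverse α-isoʳ) ⟩
    (α⇐ ⊗₁ id) ∘ (((id ⊗₁ σ) ⊗₁ id) ∘ (α⇐ ∘ ((id ⊗₁ α⇐) ∘ ((id ⊗₁ (id ⊗₁ σ)) ∘ ((id ⊗₁ α⇒) ∘ α⇒)))))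
      ≈⟨ refl⟩∘⟨ extendʳ (sym α⇐-natural) ⟩
    (α⇐ ⊗₁ id) ∘ (α⇐ ∘ ((id ⊗₁ (σ ⊗₁ id)) ∘ ((id ⊗₁ α⇐) ∘ ((id ⊗₁ (id ⊗₁ σ)) ∘ ((id ⊗₁ α⇒) ∘ α⇒)))))
      ≈⟨ trans (pullˡ pentagon-α⇐⊗id∘α⇐) assoc²′ ⟩
    α⇐ ∘ (α⇐ ∘ ((id ⊗₁ α⇒) ∘ ((id ⊗₁ (σ ⊗₁ id)) ∘ ((id ⊗₁ α⇐) ∘ ((id ⊗₁ (id ⊗₁ σ)) ∘ ((id ⊗₁ α⇒) ∘ α⇒))))))
      ≈⟨ refl⟩∘⟨ refl⟩∘⟨ id⊗-merge₅ ⟩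
    α⇐ ∘ (α⇐ ∘ ((id ⊗₁ (α⇒ ∘ ((σ ⊗₁ id) ∘ (α⇐ ∘ ((id ⊗₁ σ) ∘ α⇒))))) ∘ α⇒))
      ≈⟨ refl⟩∘⟨ refl⟩∘⟨ (refl⟩⊗⟨ sym braiding-⊗ˡ) ⟩∘⟨refl ⟩
    α⇐ ∘ (α⇐ ∘ ((id ⊗₁ σ) ∘ α⇒))
      ∎

  swap₁₂-natural₃ : ∀ {h : Hom Z D} → (id {X} ⊗₁ (id {Y} ⊗₁ h)) ∘ swap₁₂ ≈ swap₁₂ ∘ (id ⊗₁ (id ⊗₁ h))
  swap₁₂-natural₃ {h = h} = begin
    (id ⊗₁ (id ⊗₁ h)) ∘ (α⇒ ∘ ((σ ⊗₁ id) ∘ α⇐))   ≈⟨ extendʳ id⊗id⊗-α⇒ ⟩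
    α⇒ ∘ ((id ⊗₁ h) ∘ ((σ ⊗₁ id) ∘ α⇐))           ≈⟨ refl⟩∘⟨ extendʳ (sym ⊗id-id⊗-commute) ⟩
    α⇒ ∘ ((σ ⊗₁ id) ∘ ((id ⊗₁ h) ∘ α⇐))           ≈⟨ refl⟩∘⟨ refl⟩∘⟨ id⊗-α⇐ ⟩
    α⇒ ∘ ((σ ⊗₁ id) ∘ (α⇐ ∘ (id ⊗₁ (id ⊗₁ h))))   ≈⟨ sym assoc²′ ⟩
    (α⇒ ∘ ((σ ⊗₁ id) ∘ α⇐)) ∘ (id ⊗₁ (id ⊗₁ h))   ∎

  swap₁₂-unit : (id ⊗₁ ρ⇒) ∘ swap₁₂ {X} {Y} {I} ≈ σ ∘ (id ⊗₁ ρ⇒)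
  swap₁₂-unit = begin
    (id ⊗₁ ρ⇒) ∘ (α⇒ ∘ ((σ ⊗₁ id) ∘ α⇐))   ≈⟨ pullˡ coherence₂ ⟩
    ρ⇒ ∘ ((σ ⊗₁ id) ∘ α⇐)                  ≈⟨ pullˡ (sym ρ-natural) ⟩
    (σ ∘ ρ⇒) ∘ α⇐                          ≈⟨ trans assoc (refl⟩∘⟨ coherence₂-inv) ⟩
    σ ∘ (id ⊗₁ ρ⇒)                         ∎

  interchange₄-natural₄ : ∀ {h : Hom D Z} →
    (id {A ⊗₀ C} ⊗₁ (id {B} ⊗₁ h)) ∘ interchange₄ ≈ interchange₄ ∘ (id ⊗₁ (id ⊗₁ h))
  interchange₄-natural₄ {h = h} = begin
    (id ⊗₁ (id ⊗₁ h)) ∘ (α⇐ ∘ ((id ⊗₁ swap₁₂) ∘ α⇒))            ≈⟨ extendʳ id⊗-α⇐ ⟩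
    α⇐ ∘ ((id ⊗₁ (id ⊗₁ (id ⊗₁ h))) ∘ ((id ⊗₁ swap₁₂) ∘ α⇒))    ≈⟨ refl⟩∘⟨ extendʳ id⊗swap₁₂-natural ⟩
    α⇐ ∘ ((id ⊗₁ swap₁₂) ∘ ((id ⊗₁ (id ⊗₁ (id ⊗₁ h))) ∘ α⇒))    ≈⟨ refl⟩∘⟨ refl⟩∘⟨ id⊗id⊗-α⇒ ⟩
    α⇐ ∘ ((id ⊗₁ swap₁₂) ∘ (α⇒ ∘ (id ⊗₁ (id ⊗₁ h))))            ≈⟨ sym assoc²′ ⟩
    (α⇐ ∘ ((id ⊗₁ swap₁₂) ∘ α⇒)) ∘ (id ⊗₁ (id ⊗₁ h))            ∎
    where
    id⊗swap₁₂-natural : (id ⊗₁ (id ⊗₁ (id ⊗₁ h))) ∘ (id {A} ⊗₁ swap₁₂ {B} {C}) ≈ (id ⊗₁ swap₁₂) ∘ (id ⊗₁ (id ⊗₁ (id ⊗₁ h)))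
    id⊗swap₁₂-natural = trans id⊗-merge (trans (refl⟩⊗⟨ swap₁₂-natural₃) (sym id⊗-merge))

  interchange₄-unit : (id ⊗₁ ρ⇒) ∘ interchange₄ {A} {B} {C} {I} ≈ swap₂₃ ∘ (id ⊗₁ ρ⇒)
  interchange₄-unit = begin
    (id ⊗₁ ρ⇒) ∘ (α⇐ ∘ ((id ⊗₁ swap₁₂) ∘ α⇒))       ≈⟨ extendʳ id⊗-α⇐ ⟩
    α⇐ ∘ ((id ⊗₁ (id ⊗₁ ρ⇒)) ∘ ((id ⊗₁ swap₁₂) ∘ α⇒)) ≈⟨ refl⟩∘⟨ pullˡ id⊗-merge ⟩
    α⇐ ∘ ((id ⊗₁ ((id ⊗₁ ρ⇒) ∘ swap₁₂)) ∘ α⇒)        ≈⟨ refl⟩∘⟨ (refl⟩⊗⟨ swap₁₂-unit) ⟩∘⟨refl ⟩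
    α⇐ ∘ ((id ⊗₁ (σ ∘ (id ⊗₁ ρ⇒))) ∘ α⇒)             ≈⟨ refl⟩∘⟨ pushˡ (sym id⊗-merge) ⟩
    α⇐ ∘ ((id ⊗₁ σ) ∘ ((id ⊗₁ (id ⊗₁ ρ⇒)) ∘ α⇒))     ≈⟨ refl⟩∘⟨ refl⟩∘⟨ id⊗id⊗-α⇒ ⟩
    α⇐ ∘ ((id ⊗₁ σ) ∘ (α⇒ ∘ (id ⊗₁ ρ⇒)))             ≈⟨ sym assoc²′ ⟩
    (α⇐ ∘ ((id ⊗₁ σ) ∘ α⇒)) ∘ (id ⊗₁ ρ⇒)             ∎

module TensorComonads {o ℓ e} (𝒞 : SymmetricMonoidalCategory o ℓ e) where
  open SymmetricMonoidalCategory 𝒞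
  open MonoidalReasoning 𝒞
  open Shuffles 𝒞
  open CoKleisliLifting cat

  record Comonoid : Set (o ⊔ ℓ ⊔ e) where
    field
      U       : Obj
      ε       : Hom U I
      δ       : Hom U (U ⊗₀ U)
      counitʳ : ρ⇒ ∘ ((id ⊗₁ ε) ∘ δ) ≈ id
      counitˡ : λ⇒ ∘ ((ε ⊗₁ id) ∘ δ) ≈ id
      coassoc : α⇐ ∘ ((id ⊗₁ δ) ∘ δ) ≈ (δ ⊗₁ id) ∘ δ

    counitʳ-ρ⇐ : (id ⊗₁ ε) ∘ δ ≈ ρ⇐
    counitʳ-ρ⇐ = trans (sym (cancelˡ ρ-isoˡ)) (trans (refl⟩∘⟨ counitʳ) identityʳ)

  ⊗-comonad : (M : Comonoid) → let open Comonoid M in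
              IsComonad Obj Hom _≈_ id _∘_ (λ A → A ⊗₀ U) (λ f → f ⊗₁ id {U})
  ⊗-comonad M = record
    { F-resp-≈       = _⟩⊗⟨refl
    ; F-identity     = ⊗-identity
    ; F-homomorphism = trans (refl⟩⊗⟨ sym identityˡ) ⊗-homomorphism
    ; ε              = λ A → ρ⇒ ∘ (id ⊗₁ ε)
    ; δ              = λ A → α⇐ ∘ (id ⊗₁ δ)
    ; ε-natural      = ε-natural
    ; δ-natural      = δ-natural
    ; counitˡ        = comonad-counitˡ
    ; counitʳ        = comonad-counitʳ
    ; coassoc        = comonad-coassoc
    }
    where
    open Comonoid M

    ε-natural : ∀ {A B} {f : Hom A B} → f ∘ (ρ⇒ ∘ (id ⊗₁ ε)) ≈ (ρ⇒ ∘ (id ⊗₁ ε)) ∘ (f ⊗₁ id)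
    ε-natural {f = f} = begin
      f ∘ (ρ⇒ ∘ (id ⊗₁ ε))               ≈⟨ pullˡ ρ-natural ⟩
      (ρ⇒ ∘ (f ⊗₁ id)) ∘ (id ⊗₁ ε)       ≈⟨ trans assoc (refl⟩∘⟨ ⊗id-id⊗-commute) ⟩
      ρ⇒ ∘ ((id ⊗₁ ε) ∘ (f ⊗₁ id))       ≈⟨ sym-assoc ⟩
      (ρ⇒ ∘ (id ⊗₁ ε)) ∘ (f ⊗₁ id)       ∎

    δ-natural : ∀ {A B} {f : Hom A B} → ((f ⊗₁ id) ⊗₁ id) ∘ (α⇐ ∘ (id ⊗₁ δ)) ≈ (α⇐ ∘ (id ⊗₁ δ)) ∘ (f ⊗₁ id)
    δ-natural {f = f} = begin
      ((f ⊗₁ id) ⊗₁ id) ∘ (α⇐ ∘ (id ⊗₁ δ))   ≈⟨ extendʳ (sym α⇐-natural) ⟩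
      α⇐ ∘ ((f ⊗₁ (id ⊗₁ id)) ∘ (id ⊗₁ δ))   ≈⟨ refl⟩∘⟨ (refl⟩⊗⟨ ⊗-identity) ⟩∘⟨refl ⟩
      α⇐ ∘ ((f ⊗₁ id) ∘ (id ⊗₁ δ))           ≈⟨ refl⟩∘⟨ ⊗id-id⊗-commute ⟩
      α⇐ ∘ ((id ⊗₁ δ) ∘ (f ⊗₁ id))           ≈⟨ sym-assoc ⟩
      (α⇐ ∘ (id ⊗₁ δ)) ∘ (f ⊗₁ id)           ∎

    comonad-counitˡ : ∀ {A} → (ρ⇒ ∘ (id {A ⊗₀ U} ⊗₁ ε)) ∘ (α⇐ ∘ (id ⊗₁ δ)) ≈ id
    comonad-counitˡ = begin
      (ρ⇒ ∘ (id ⊗₁ ε)) ∘ (α⇐ ∘ (id ⊗₁ δ))          ≈⟨ trans assoc (refl⟩∘⟨ extendʳ id⊗-α⇐) ⟩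
      ρ⇒ ∘ (α⇐ ∘ ((id ⊗₁ (id ⊗₁ ε)) ∘ (id ⊗₁ δ)))  ≈⟨ pullˡ coherence₂-inv ⟩
      (id ⊗₁ ρ⇒) ∘ ((id ⊗₁ (id ⊗₁ ε)) ∘ (id ⊗₁ δ)) ≈⟨ trans (refl⟩∘⟨ id⊗-merge) id⊗-merge ⟩
      id ⊗₁ (ρ⇒ ∘ ((id ⊗₁ ε) ∘ δ))                 ≈⟨ trans (refl⟩⊗⟨ counitʳ) ⊗-identity ⟩
      id                                           ∎

    comonad-counitʳ : ∀ {A} → ((ρ⇒ ∘ (id {A} ⊗₁ ε)) ⊗₁ id) ∘ (α⇐ ∘ (id ⊗₁ δ)) ≈ id
    comonad-counitʳ = begin
      ((ρ⇒ ∘ (id ⊗₁ ε)) ⊗₁ id) ∘ (α⇐ ∘ (id ⊗₁ δ))          ≈⟨ sym ⊗id-merge ⟩∘⟨refl ⟩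
      ((ρ⇒ ⊗₁ id) ∘ ((id ⊗₁ ε) ⊗₁ id)) ∘ (α⇐ ∘ (id ⊗₁ δ))  ≈⟨ trans assoc (refl⟩∘⟨ extendʳ (sym α⇐-natural)) ⟩
      (ρ⇒ ⊗₁ id) ∘ (α⇐ ∘ ((id ⊗₁ (ε ⊗₁ id)) ∘ (id ⊗₁ δ)))  ≈⟨ pullˡ triangle-inv ⟩
      (id ⊗₁ λ⇒) ∘ ((id ⊗₁ (ε ⊗₁ id)) ∘ (id ⊗₁ δ))         ≈⟨ trans (refl⟩∘⟨ id⊗-merge) id⊗-merge ⟩
      id ⊗₁ (λ⇒ ∘ ((ε ⊗₁ id) ∘ δ))                         ≈⟨ trans (refl⟩⊗⟨ counitˡ) ⊗-identity ⟩
      id                                                   ∎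

    comonad-coassoc : ∀ {A} → (α⇐ ∘ (id {A ⊗₀ U} ⊗₁ δ)) ∘ (α⇐ ∘ (id ⊗₁ δ)) ≈ ((α⇐ ∘ (id ⊗₁ δ)) ⊗₁ id) ∘ (α⇐ ∘ (id ⊗₁ δ))
    comonad-coassoc = begin
      (α⇐ ∘ (id ⊗₁ δ)) ∘ (α⇐ ∘ (id ⊗₁ δ))                    ≈⟨ trans assoc (refl⟩∘⟨ extendʳ id⊗-α⇐) ⟩
      α⇐ ∘ (α⇐ ∘ ((id ⊗₁ (id ⊗₁ δ)) ∘ (id ⊗₁ δ)))            ≈⟨ trans sym-assoc (sym pentagon-inv ⟩∘⟨ id⊗-merge) ⟩
      ((α⇐ ⊗₁ id) ∘ (α⇐ ∘ (id ⊗₁ α⇐))) ∘ (id ⊗₁ ((id ⊗₁ δ) ∘ δ)) ≈⟨ trans assoc²′ (refl⟩∘⟨ refl⟩∘⟨ id⊗-merge) ⟩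
      (α⇐ ⊗₁ id) ∘ (α⇐ ∘ (id ⊗₁ (α⇐ ∘ ((id ⊗₁ δ) ∘ δ))))     ≈⟨ refl⟩∘⟨ refl⟩∘⟨ refl⟩⊗⟨ coassoc ⟩
      (α⇐ ⊗₁ id) ∘ (α⇐ ∘ (id ⊗₁ ((δ ⊗₁ id) ∘ δ)))            ≈⟨ refl⟩∘⟨ refl⟩∘⟨ sym id⊗-merge ⟩
      (α⇐ ⊗₁ id) ∘ (α⇐ ∘ ((id ⊗₁ (δ ⊗₁ id)) ∘ (id ⊗₁ δ)))    ≈⟨ refl⟩∘⟨ pullˡ α⇐-natural ⟩
      (α⇐ ⊗₁ id) ∘ (((id ⊗₁ δ) ⊗₁ id) ∘ α⇐) ∘ (id ⊗₁ δ)      ≈⟨ trans (refl⟩∘⟨ assoc) sym-assoc ⟩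
      ((α⇐ ⊗₁ id) ∘ ((id ⊗₁ δ) ⊗₁ id)) ∘ (α⇐ ∘ (id ⊗₁ δ))    ≈⟨ ⊗id-merge ⟩∘⟨refl ⟩
      ((α⇐ ∘ (id ⊗₁ δ)) ⊗₁ id) ∘ (α⇐ ∘ (id ⊗₁ δ))            ∎

  centralIdempotent-comonoid : CentralIdempotent 𝒞 → Comonoid
  centralIdempotent-comonoid w = record
    { U       = U
    ; ε       = u
    ; δ       = μ⁻¹
    ; counitʳ = trans sym-assoc μ-isoʳ
    ; counitˡ = trans sym-assoc (trans (sym central ⟩∘⟨refl) μ-isoʳ)
    ; coassoc = trans (refl⟩∘⟨ sym μ⁻¹-coassoc) (cancelˡ α-isoˡ)
    }
    where
    open CentralIdempotent w

    μ-assoc : μ ∘ ((μ ⊗₁ id) ∘ α⇐) ≈ μ ∘ (id ⊗₁ μ)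
    μ-assoc = begin
      μ ∘ ((μ ⊗₁ id) ∘ α⇐)                      ≈⟨ sym-assoc ⟩
      ((ρ⇒ ∘ (id ⊗₁ u)) ∘ (μ ⊗₁ id)) ∘ α⇐       ≈⟨ trans assoc (refl⟩∘⟨ sym ⊗id-id⊗-commute) ⟩∘⟨refl ⟩
      (ρ⇒ ∘ ((μ ⊗₁ id) ∘ (id ⊗₁ u))) ∘ α⇐       ≈⟨ pullˡ (sym ρ-natural) ⟩∘⟨refl ⟩
      ((μ ∘ ρ⇒) ∘ (id ⊗₁ u)) ∘ α⇐               ≈⟨ trans assoc assoc ⟩
      μ ∘ (ρ⇒ ∘ ((id ⊗₁ u) ∘ α⇐))               ≈⟨ refl⟩∘⟨ refl⟩∘⟨ id⊗-α⇐ ⟩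
      μ ∘ (ρ⇒ ∘ (α⇐ ∘ (id ⊗₁ (id ⊗₁ u))))       ≈⟨ refl⟩∘⟨ pullˡ coherence₂-inv ⟩
      μ ∘ ((id ⊗₁ ρ⇒) ∘ (id ⊗₁ (id ⊗₁ u)))      ≈⟨ refl⟩∘⟨ id⊗-merge ⟩
      μ ∘ (id ⊗₁ μ)                             ∎

    μ⁻¹-coassoc : α⇒ ∘ ((μ⁻¹ ⊗₁ id) ∘ μ⁻¹) ≈ (id ⊗₁ μ⁻¹) ∘ μ⁻¹
    μ⁻¹-coassoc = inverse-unique μ-assoc
      (trans assoc²′ (trans (refl⟩∘⟨ refl⟩∘⟨ cancelˡ μ-isoˡ) (trans (refl⟩∘⟨ cancelˡ (⊗id-inverse μ-isoˡ)) α-isoʳ)))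
      (trans assoc (trans (refl⟩∘⟨ pullˡ (id⊗-inverse μ-isoʳ)) (trans (refl⟩∘⟨ identityˡ) μ-isoʳ)))

  swap-distributiveLaw : (M N : Comonoid) → DistributiveLaw (⊗-comonad N) (⊗-comonad M)
  swap-distributiveLaw M N = record
    { β         = swap₂₃
    ; β-natural = swap₂₃-natural
    ; β-εᵀ      = β-εᵀ
    ; β-δᵀ      = β-δᵀ
    ; β-εˢ      = β-εˢ
    ; β-δˢ      = β-δˢ
    }
    where
    module M = Comonoid M
    module N = Comonoid N
    W V : Obj
    W = M.U
    V = N.U

    id⊗id⊗ : ∀ {A B X Y} {h : Hom X Y} → id {A ⊗₀ B} ⊗₁ h ≈ (id ⊗₁ id) ⊗₁ h
    id⊗id⊗ = sym ⊗-identity ⟩⊗⟨refl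

    β-εᵀ : ∀ {A} → ((ρ⇒ ∘ (id ⊗₁ N.ε)) ⊗₁ id) ∘ swap₂₃ {A} {W} {V} ≈ ρ⇒ ∘ (id ⊗₁ N.ε)
    β-εᵀ = begin
      ((ρ⇒ ∘ (id ⊗₁ N.ε)) ⊗₁ id) ∘ swap₂₃          ≈⟨ trans (sym ⊗id-merge ⟩∘⟨refl) assoc ⟩
      (ρ⇒ ⊗₁ id) ∘ (((id ⊗₁ N.ε) ⊗₁ id) ∘ swap₂₃)  ≈⟨ refl⟩∘⟨ swap₂₃-natural ⟩
      (ρ⇒ ⊗₁ id) ∘ (swap₂₃ ∘ ((id ⊗₁ id) ⊗₁ N.ε))  ≈⟨ pullˡ swap₂₃-unit₃ ⟩
      ρ⇒ ∘ ((id ⊗₁ id) ⊗₁ N.ε)                     ≈⟨ refl⟩∘⟨ sym id⊗id⊗ ⟩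
      ρ⇒ ∘ (id ⊗₁ N.ε)                             ∎

    β-δᵀ : ∀ {A} → ((α⇐ ∘ (id ⊗₁ N.δ)) ⊗₁ id) ∘ swap₂₃ {A} {W} {V}
                   ≈ swap₂₃ ∘ ((swap₂₃ ⊗₁ id) ∘ (α⇐ ∘ (id ⊗₁ N.δ)))
    β-δᵀ = begin
      ((α⇐ ∘ (id ⊗₁ N.δ)) ⊗₁ id) ∘ swap₂₃                   ≈⟨ trans (sym ⊗id-merge ⟩∘⟨refl) assoc ⟩
      (α⇐ ⊗₁ id) ∘ (((id ⊗₁ N.δ) ⊗₁ id) ∘ swap₂₃)           ≈⟨ refl⟩∘⟨ swap₂₃-natural ⟩
      (α⇐ ⊗₁ id) ∘ (swap₂₃ ∘ ((id ⊗₁ id) ⊗₁ N.δ))           ≈⟨ pullˡ (sym swap₂₃-⊗₃) ⟩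
      (swap₂₃ ∘ ((swap₂₃ ⊗₁ id) ∘ α⇐)) ∘ ((id ⊗₁ id) ⊗₁ N.δ) ≈⟨ assoc²′ ⟩
      swap₂₃ ∘ ((swap₂₃ ⊗₁ id) ∘ (α⇐ ∘ ((id ⊗₁ id) ⊗₁ N.δ))) ≈⟨ refl⟩∘⟨ refl⟩∘⟨ refl⟩∘⟨ sym id⊗id⊗ ⟩
      swap₂₃ ∘ ((swap₂₃ ⊗₁ id) ∘ (α⇐ ∘ (id ⊗₁ N.δ)))        ∎

    β-εˢ : ∀ {A} → (ρ⇒ ∘ (id ⊗₁ M.ε)) ∘ swap₂₃ {A} {W} {V} ≈ (ρ⇒ ∘ (id ⊗₁ M.ε)) ⊗₁ id
    β-εˢ = begin
      (ρ⇒ ∘ (id ⊗₁ M.ε)) ∘ swap₂₃               ≈⟨ trans assoc (refl⟩∘⟨ id⊗id⊗ ⟩∘⟨refl) ⟩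
      ρ⇒ ∘ (((id ⊗₁ id) ⊗₁ M.ε) ∘ swap₂₃)       ≈⟨ refl⟩∘⟨ swap₂₃-natural ⟩
      ρ⇒ ∘ (swap₂₃ ∘ ((id ⊗₁ M.ε) ⊗₁ id))       ≈⟨ pullˡ swap₂₃-unit₂ ⟩
      (ρ⇒ ⊗₁ id) ∘ ((id ⊗₁ M.ε) ⊗₁ id)          ≈⟨ ⊗id-merge ⟩
      (ρ⇒ ∘ (id ⊗₁ M.ε)) ⊗₁ id                  ∎

    β-δˢ : ∀ {A} → (α⇐ ∘ (id ⊗₁ M.δ)) ∘ swap₂₃ {A} {W} {V}
                   ≈ (swap₂₃ ⊗₁ id) ∘ (swap₂₃ ∘ ((α⇐ ∘ (id ⊗₁ M.δ)) ⊗₁ id))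
    β-δˢ = begin
      (α⇐ ∘ (id ⊗₁ M.δ)) ∘ swap₂₃                                  ≈⟨ trans assoc (refl⟩∘⟨ id⊗id⊗ ⟩∘⟨refl) ⟩
      α⇐ ∘ (((id ⊗₁ id) ⊗₁ M.δ) ∘ swap₂₃)                          ≈⟨ refl⟩∘⟨ swap₂₃-natural ⟩
      α⇐ ∘ (swap₂₃ ∘ ((id ⊗₁ M.δ) ⊗₁ id))                          ≈⟨ pullˡ (sym swap₂₃-⊗₂) ⟩
      ((swap₂₃ ⊗₁ id) ∘ (swap₂₃ ∘ (α⇐ ⊗₁ id))) ∘ ((id ⊗₁ M.δ) ⊗₁ id) ≈⟨ trans assoc²′ (refl⟩∘⟨ refl⟩∘⟨ ⊗id-merge) ⟩
      (swap₂₃ ⊗₁ id) ∘ (swap₂₃ ∘ ((α⇐ ∘ (id ⊗₁ M.δ)) ⊗₁ id))       ∎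

  interchange-counit≈swap₂₃ : (N : Comonoid) → let open Comonoid N in
    ∀ {A B C} {f : Hom (A ⊗₀ U) B} →
    (f ⊗₁ (ρ⇒ ∘ (id {C} ⊗₁ ε))) ∘ (interchange₄ ∘ (id ⊗₁ δ)) ≈ (f ⊗₁ id) ∘ swap₂₃
  interchange-counit≈swap₂₃ N {f = f} = begin
    (f ⊗₁ (ρ⇒ ∘ (id ⊗₁ ε))) ∘ (interchange₄ ∘ (id ⊗₁ δ))           ≈⟨ trans (trans (sym identityʳ ⟩⊗⟨refl) ⊗-homomorphism ⟩∘⟨refl) assoc ⟩
    (f ⊗₁ ρ⇒) ∘ ((id ⊗₁ (id ⊗₁ ε)) ∘ (interchange₄ ∘ (id ⊗₁ δ)))   ≈⟨ refl⟩∘⟨ extendʳ interchange₄-natural₄ ⟩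
    (f ⊗₁ ρ⇒) ∘ (interchange₄ ∘ ((id ⊗₁ (id ⊗₁ ε)) ∘ (id ⊗₁ δ)))   ≈⟨ refl⟩∘⟨ refl⟩∘⟨ trans id⊗-merge (refl⟩⊗⟨ counitʳ-ρ⇐) ⟩
    (f ⊗₁ ρ⇒) ∘ (interchange₄ ∘ (id ⊗₁ ρ⇐))                       ≈⟨ pushˡ serialize₁₂ ⟩
    (f ⊗₁ id) ∘ ((id ⊗₁ ρ⇒) ∘ (interchange₄ ∘ (id ⊗₁ ρ⇐)))        ≈⟨ refl⟩∘⟨ pullˡ interchange₄-unit ⟩
    (f ⊗₁ id) ∘ ((swap₂₃ ∘ (id ⊗₁ ρ⇒)) ∘ (id ⊗₁ ρ⇐))              ≈⟨ refl⟩∘⟨ cancelʳ (id⊗-inverse ρ-isoʳ) ⟩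
    (f ⊗₁ id) ∘ swap₂₃                                            ∎
    where open Comonoid N

lemma4p1 : ∀ {o ℓ e : Level} (𝒞 : SymmetricMonoidalCategory o ℓ e) →
    let open SymmetricMonoidalCategory 𝒞 in
    ((w : CentralIdempotent 𝒞) →
      IsComonad Obj Hom _≈_ id _∘_
        (λ A → A ⊗₀ CentralIdempotent.U w)
        (λ f → f ⊗₁ id {CentralIdempotent.U w}))
    × ((w v : CentralIdempotent 𝒞) → _≤ᶜ_ 𝒞 w v →
      let open Restrict 𝒞 v in
      IsComonad Obj Homᵥ _≈_ idᵥ _∘ᵥ_
        (λ A → A ⊗₀ CentralIdempotent.U w)
        (λ f → f ⊗ᵥ idᵥ {CentralIdempotent.U w}))
lemma4p1 𝒞 =
    (λ w → ⊗-comonad (comonoid w))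
  , λ w v _ →
      coKleisli-lift (⊗-comonad (comonoid v)) (⊗-comonad (comonoid w))
                     (swap-distributiveLaw (comonoid w) (comonoid v))
                     (interchange-counit≈swap₂₃ (comonoid v))
  where
  open SymmetricMonoidalCategory 𝒞
  open TensorComonads 𝒞
  open CoKleisliLifting cat

  comonoid : CentralIdempotent 𝒞 → Comonoid
  comonoid = centralIdempotent-comonoid
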